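{- Let $z$ be an indeterminate (treated as a scalar) and let $A=\{a_0,a_1,a_2,\dots,b,c\}$ be an alphabet. For each $k\ge 1$ let $G_k$ be the context-free grammar $$G_k=\{a_0\to a_1c,\ a_1\to a_2bc,\ a_2\to a_3b^2c,\ \dots,\ a_{k-1}\to a_kb^{k-1}c,\ b\to 2b,\ c\to(1+z)c\},$$ and let $D_k$ be the formal derivative associated with $G_k$. Then for every $n\ge 1$, $$D_nD_{n-1}\cdots D_1(a_0)=\sum_{k=1}^n \mathrm{JS}_n^k(z)\,a_k\,b^{\binom{k}{2}}c^k.$$
   Context: A context-free grammar $G$ over an alphabet $A$ assigns to each letter of $A$ an element of the ring $\mathbb{Q}[z][[A]]$ of formal power series in the letters of $A$ (with scalars polynomials in $z$). The formal derivative $D=D_G$ is the unique $\mathbb{Q}[z]$-linear derivation (satisfying the Leibniz rule on products) with $D(x)=G(x)$ for each letter $x$; letters without a rule in $G$ (here $a_j$ for $j\ge k$ in $G_k$) are mapped to $0$. The Jacobi-Stirling numbers of the second kind $\mathrm{JS}_n^k(z)$ are defined by $\mathrm{JS}_n^k(z)=\mathrm{JS}_{n-1}^{k-1}(z)+k(k+z)\mathrm{JS}_{n-1}^k(z)$ with $\mathrm{JS}_n^0(z)=\delta_{n,0}$ and $\mathrm{JS}_0^k(z)=\delta_{0,k}$; equivalently $x^n=\sum_{k=0}^n\mathrm{JS}_n^k(z)\prod_{i=0}^{k-1}(x-i(z+i))$. -}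

module Defs where

open import Level using (Level)
open import Data.Nat using (ℕ; zero; suc; _<ᵇ_)
open import Data.Bool using (if_then_else_)
open import Algebra.Bundles using (CommutativeRing)

data Var : Set where
  vz : Var
  va : ℕ → Var
  vb : Var
  vc : Var

-- Two expressions denote the same element of Q[z][A] iff they evaluate
-- equally in every commutative ring (all coefficients here are integral).
data Expr : Set where
  var  : Var → Expr
  num  : ℕ → Expr
  _⊕_  : Expr → Expr → Expr
  _⊗_  : Expr → Expr → Expr

infixl 6 _⊕_
infixl 7 _⊗_

pow : Expr → ℕ → Expr
pow e zero    = num 1
pow e (suc m) = e ⊗ pow e m

D : ℕ → Expr → Expr
D k (var vz)     = num 0
D k (var (va j)) = if j <ᵇ k then var (va (suc j)) ⊗ pow (var vb) j ⊗ var vc else num 0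
D k (var vb)     = num 2 ⊗ var vb
D k (var vc)     = (num 1 ⊕ var vz) ⊗ var vc
D k (num m)      = num 0
D k (e ⊕ f)      = D k e ⊕ D k f
D k (e ⊗ f)      = D k e ⊗ f ⊕ e ⊗ D k f

Dseq : ℕ → Expr → Expr
Dseq zero    e = e
Dseq (suc n) e = D (suc n) (Dseq n e)

JS : ℕ → ℕ → Expr
JS zero    zero    = num 1
JS zero    (suc k) = num 0
JS (suc n) zero    = num 0
JS (suc n) (suc k) = JS n k ⊕ num (suc k) ⊗ (num (suc k) ⊕ var vz) ⊗ JS n (suc k)

Σ₁ : ℕ → (ℕ → Expr) → Expr
Σ₁ zero    f = num 0
Σ₁ (suc n) f = Σ₁ n f ⊕ f (suc n)

module Eval {c ℓ : Level} (R : CommutativeRing c ℓ) where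
  open CommutativeRing R

  fromℕ : ℕ → Carrier
  fromℕ zero    = 0#
  fromℕ (suc m) = 1# + fromℕ m

  ⟦_⟧ : Expr → (Var → Carrier) → Carrier
  ⟦ var x ⟧ ρ = ρ x
  ⟦ num m ⟧ ρ = fromℕ m
  ⟦ e ⊕ f ⟧ ρ = ⟦ e ⟧ ρ + ⟦ f ⟧ ρ
  ⟦ e ⊗ f ⟧ ρ = ⟦ e ⟧ ρ * ⟦ f ⟧ ρ

{-# OPTIONS --safe #-}
module Submission where

-- The identity holds in the sharper form D_n ⋯ D_1 a₀ = Σ_{k=0}^{n} JS_n^k a_k b^(k C 2) c^k
-- (whose k = 0 summand vanishes once n ≥ 1), by induction on n.  For k ≤ n, D_{n+1} is
-- diagonal-plus-shift on these monomials:
--   D_{n+1} (a_k b^(k C 2) c^k) = a_{k+1} b^((k+1) C 2) c^{k+1} + k(k+z) a_k b^(k C 2) c^k,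
-- since b^j and c^j are eigenvectors with eigenvalues 2j and j(1+z), and 2·(k C 2) + k = k².
-- Collecting coefficients reproduces the recurrence of JS.  The induction hypothesis only
-- equates values in every commutative ring, so D_{n+1} must be shown to respect such
-- equalities: evaluating in the dual numbers R[ε] at x + ε·D(x) yields e + ε·D(e) for every e.

open import Defs
open import Level using (Level; _⊔_) renaming (suc to lsuc)
open import Data.Nat using (ℕ; _≤_)
open import Data.Nat.Combinatorics using (_C_)
open import Algebra.Bundles using (CommutativeRing)

open import Algebra.Bundles using (CommutativeMonoid; AbelianGroup; Semiring)
open import Algebra.Structures using (IsCommutativeRing)
open import Algebra.Construct.DirectProduct using (abelianGroup)
import Algebra.Properties.Semiring.Mult as SemiringMult
import Algebra.Solver.Ring.NaturalCoefficients.Default as NaturalSolver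
open import Data.Bool using (true)
open import Data.Nat as ℕ using (zero; suc; _<_; _<ᵇ_; s≤s; z≤n)
open import Data.Nat.Properties using (<⇒<ᵇ; ≤-refl; m≤n⇒m≤1+n; n<1+n)
open import Data.Nat.Combinatorics using (nCk+nC[k+1]≡[n+1]C[k+1]; nC1≡n)
open import Data.Nat.Tactic.RingSolver using (solve-∀)
open import Data.Product using (_,_; proj₂; zip; map)
open import Data.Product.Relation.Binary.Pointwise.NonDependent using (Pointwise)
open import Relation.Binary.PropositionalEquality as ≡ using (_≡_; module ≡-Reasoning)
import Relation.Binary.Reasoning.Setoid as SetoidReasoning

[1+n]C2≡n+nC2 : ∀ n → suc n C 2 ≡ n ℕ.+ n C 2
[1+n]C2≡n+nC2 n = ≡.trans (≡.sym (nCk+nC[k+1]≡[n+1]C[k+1] n 1)) (≡.cong (ℕ._+ n C 2) (nC1≡n n))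

nC2+nC2+n≡n*n : ∀ n → n C 2 ℕ.+ n C 2 ℕ.+ n ≡ n ℕ.* n
nC2+nC2+n≡n*n zero    = ≡.refl
nC2+nC2+n≡n*n (suc n) = begin
  suc n C 2 + suc n C 2 + suc n         ≡⟨ ≡.cong (λ x → x + x + suc n) ([1+n]C2≡n+nC2 n) ⟩
  (n + n C 2) + (n + n C 2) + suc n     ≡⟨ regroup n (n C 2) ⟩
  (n C 2 + n C 2 + n) + (n + n + 1)     ≡⟨ ≡.cong (_+ (n + n + 1)) (nC2+nC2+n≡n*n n) ⟩
  n * n + (n + n + 1)                   ≡⟨ square-suc n ⟩
  suc n * suc n                         ∎
  where
  open Data.Nat using (_+_; _*_)
  open ≡-Reasoning
  regroup : ∀ n x → (n + x) + (n + x) + suc n ≡ (x + x + n) + (n + n + 1)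
  regroup = solve-∀
  square-suc : ∀ n → n * n + (n + n + 1) ≡ suc n * suc n
  square-suc = solve-∀

module RangeSum {c ℓ : Level} (M : CommutativeMonoid c ℓ) where
  open CommutativeMonoid M
  open import Algebra.Properties.CommutativeSemigroup commutativeSemigroup using (interchange)
  open SetoidReasoning setoid

  ∑≤ : ℕ → (ℕ → Carrier) → Carrier
  ∑≤ zero    g = g 0
  ∑≤ (suc n) g = ∑≤ n g ∙ g (suc n)

  ∑≤-cong : ∀ n {g h} → (∀ k → k ≤ n → g k ≈ h k) → ∑≤ n g ≈ ∑≤ n h
  ∑≤-cong zero    g≈h = g≈h 0 z≤n
  ∑≤-cong (suc n) g≈h = ∙-cong (∑≤-cong n (λ k k≤n → g≈h k (m≤n⇒m≤1+n k≤n))) (g≈h (suc n) ≤-refl)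

  ∑≤-distrib : ∀ n g h → ∑≤ n (λ k → g k ∙ h k) ≈ ∑≤ n g ∙ ∑≤ n h
  ∑≤-distrib zero    g h = refl
  ∑≤-distrib (suc n) g h = trans (∙-congʳ (∑≤-distrib n g h)) (interchange _ _ _ _)

  ∑≤-suc : ∀ n g → ∑≤ (suc n) g ≈ g 0 ∙ ∑≤ n (λ k → g (suc k))
  ∑≤-suc zero    g = refl
  ∑≤-suc (suc n) g = trans (∙-congʳ (∑≤-suc n g)) (assoc _ _ _)

  ∑≤-shift-vanishing : ∀ n g → g 0 ≈ ε → g (suc n) ≈ ε → ∑≤ n (λ k → g (suc k)) ≈ ∑≤ n g
  ∑≤-shift-vanishing n g g₀≈ε gₙ₊₁≈ε = begin
    ∑≤ n (λ k → g (suc k))         ≈⟨ identityˡ _ ⟨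
    ε ∙ ∑≤ n (λ k → g (suc k))     ≈⟨ ∙-congʳ g₀≈ε ⟨
    g 0 ∙ ∑≤ n (λ k → g (suc k))   ≈⟨ ∑≤-suc n g ⟨
    ∑≤ n g ∙ g (suc n)             ≈⟨ ∙-congˡ gₙ₊₁≈ε ⟩
    ∑≤ n g ∙ ε                     ≈⟨ identityʳ _ ⟩
    ∑≤ n g                         ∎

module SemiringRangeSum {c ℓ : Level} (S : Semiring c ℓ) where
  open Semiring S
  open RangeSum +-commutativeMonoid public
  open SetoidReasoning setoid

  ∑≤-recurrence : ∀ n (J J′ w μ : ℕ → Carrier) → J (suc n) ≈ 0# → w 0 ≈ 0# → J′ 0 ≈ 0# →
                  (∀ k → J′ (suc k) ≈ J k + w (suc k) * J (suc k)) →
                  ∑≤ n (λ k → J k * μ (suc k) + w k * (J k * μ k)) ≈ ∑≤ (suc n) (λ k → J′ k * μ k)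
  ∑≤-recurrence n J J′ w μ Jₙ₊₁≈0 w₀≈0 J′₀≈0 J′-rec = begin
    ∑≤ n (λ k → X k + Y k)                      ≈⟨ ∑≤-distrib n X Y ⟩
    ∑≤ n X + ∑≤ n Y                              ≈⟨ +-congˡ (∑≤-shift-vanishing n Y Y₀≈0 Yₙ₊₁≈0) ⟨
    ∑≤ n X + ∑≤ n (λ k → Y (suc k))              ≈⟨ ∑≤-distrib n X (λ k → Y (suc k)) ⟨
    ∑≤ n (λ k → X k + Y (suc k))                 ≈⟨ ∑≤-cong n (λ k _ → collect k) ⟩
    ∑≤ n (λ k → J′ (suc k) * μ (suc k))          ≈⟨ +-identityˡ _ ⟨
    0# + ∑≤ n (λ k → J′ (suc k) * μ (suc k))     ≈⟨ +-congʳ (trans (*-congʳ J′₀≈0) (zeroˡ (μ 0))) ⟨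
    J′ 0 * μ 0 + ∑≤ n (λ k → J′ (suc k) * μ (suc k)) ≈⟨ ∑≤-suc n (λ k → J′ k * μ k) ⟨
    ∑≤ (suc n) (λ k → J′ k * μ k)                ∎
    where
    X Y : ℕ → Carrier
    X k = J k * μ (suc k)
    Y k = w k * (J k * μ k)

    Y₀≈0 : Y 0 ≈ 0#
    Y₀≈0 = trans (*-congʳ w₀≈0) (zeroˡ _)

    Yₙ₊₁≈0 : Y (suc n) ≈ 0#
    Yₙ₊₁≈0 = trans (*-congˡ (trans (*-congʳ Jₙ₊₁≈0) (zeroˡ _))) (zeroʳ _)

    collect : ∀ k → X k + Y (suc k) ≈ J′ (suc k) * μ (suc k)
    collect k = trans (+-congˡ (sym (*-assoc _ _ _))) (trans (sym (distribʳ _ _ _)) (*-congʳ (sym (J′-rec k))))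

module DualNumbers {c ℓ : Level} (R : CommutativeRing c ℓ) where
  open CommutativeRing R
  open import Data.Product using (_×_)
  open NaturalSolver commutativeSemiring using (solve; _:=_; _:+_; _:*_; con)

  infix  4 _≈ᵈ_
  infixl 7 _*ᵈ_

  _≈ᵈ_ : Carrier × Carrier → Carrier × Carrier → Set ℓ
  _≈ᵈ_ = Pointwise _≈_ _≈_

  _*ᵈ_ : Carrier × Carrier → Carrier × Carrier → Carrier × Carrier
  (x , x′) *ᵈ (y , y′) = x * y , x′ * y + x * y′

  private
    ε-assoc : ∀ x x′ y y′ z z′ → (x′ * y + x * y′) * z + (x * y) * z′ ≈ x′ * (y * z) + x * (y′ * z + y * z′)
    ε-assoc = solve 6 (λ x x′ y y′ z z′ →
      (x′ :* y :+ x :* y′) :* z :+ (x :* y) :* z′ := x′ :* (y :* z) :+ x :* (y′ :* z :+ y :* z′)) refl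

    ε-identityˡ : ∀ x x′ → 0# * x + 1# * x′ ≈ x′
    ε-identityˡ = solve 2 (λ x x′ → con 0 :* x :+ con 1 :* x′ := x′) refl

    ε-identityʳ : ∀ x x′ → x′ * 1# + x * 0# ≈ x′
    ε-identityʳ = solve 2 (λ x x′ → x′ :* con 1 :+ x :* con 0 := x′) refl

    ε-distribˡ : ∀ x x′ y y′ z z′ → x′ * (y + z) + x * (y′ + z′) ≈ (x′ * y + x * y′) + (x′ * z + x * z′)
    ε-distribˡ = solve 6 (λ x x′ y y′ z z′ →
      x′ :* (y :+ z) :+ x :* (y′ :+ z′) := (x′ :* y :+ x :* y′) :+ (x′ :* z :+ x :* z′)) refl

    ε-distribʳ : ∀ x x′ y y′ z z′ → (y′ + z′) * x + (y + z) * x′ ≈ (y′ * x + y * x′) + (z′ * x + z * x′)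
    ε-distribʳ = solve 6 (λ x x′ y y′ z z′ →
      (y′ :+ z′) :* x :+ (y :+ z) :* x′ := (y′ :* x :+ y :* x′) :+ (z′ :* x :+ z :* x′)) refl

    ε-comm : ∀ x x′ y y′ → x′ * y + x * y′ ≈ y′ * x + y * x′
    ε-comm = solve 4 (λ x x′ y y′ → x′ :* y :+ x :* y′ := y′ :* x :+ y :* x′) refl

  isDualNumbers : IsCommutativeRing _≈ᵈ_ (zip _+_ _+_) _*ᵈ_ (map (-_) (-_)) (0# , 0#) (1# , 0#)
  isDualNumbers = record
    { isRing = record
      { +-isAbelianGroup = AbelianGroup.isAbelianGroup (abelianGroup +-abelianGroup +-abelianGroup)
      ; *-cong     = λ (x≈y , x′≈y′) (u≈v , u′≈v′) →
                       *-cong x≈y u≈v , +-cong (*-cong x′≈y′ u≈v) (*-cong x≈y u′≈v′)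
      ; *-assoc    = λ _ _ _ → *-assoc _ _ _ , ε-assoc _ _ _ _ _ _
      ; *-identity = (λ _ → *-identityˡ _ , ε-identityˡ _ _) , (λ _ → *-identityʳ _ , ε-identityʳ _ _)
      ; distrib    = (λ _ _ _ → distribˡ _ _ _ , ε-distribˡ _ _ _ _ _ _)
                   , (λ _ _ _ → distribʳ _ _ _ , ε-distribʳ _ _ _ _ _ _)
      }
    ; *-comm = λ _ _ → *-comm _ _ , ε-comm _ _ _ _
    }

  dualNumbers : CommutativeRing c ℓ
  dualNumbers = record { isCommutativeRing = isDualNumbers }

  open Eval R

  tangent : ℕ → (Var → Carrier) → Var → Carrier × Carrier
  tangent m ρ x = ρ x , ⟦ D m (var x) ⟧ ρ

  fromℕᵈ : ∀ k → Eval.fromℕ dualNumbers k ≈ᵈ (fromℕ k , 0#)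
  fromℕᵈ zero    = refl , refl
  fromℕᵈ (suc k) with fromℕᵈ k
  ... | k₁ , k₂ = +-cong refl k₁ , trans (+-cong refl k₂) (+-identityʳ 0#)

  ⟦⟧-tangent : ∀ m ρ e → Eval.⟦_⟧ dualNumbers e (tangent m ρ) ≈ᵈ (⟦ e ⟧ ρ , ⟦ D m e ⟧ ρ)
  ⟦⟧-tangent m ρ (var x) = refl , refl
  ⟦⟧-tangent m ρ (num k) = fromℕᵈ k
  ⟦⟧-tangent m ρ (e ⊕ f) with ⟦⟧-tangent m ρ e | ⟦⟧-tangent m ρ f
  ... | e₁ , e₂ | f₁ , f₂ = +-cong e₁ f₁ , +-cong e₂ f₂
  ⟦⟧-tangent m ρ (e ⊗ f) with ⟦⟧-tangent m ρ e | ⟦⟧-tangent m ρ f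
  ... | e₁ , e₂ | f₁ , f₂ = *-cong e₁ f₁ , +-cong (*-cong e₂ f₁) (*-cong e₁ f₂)

Σ₀ : ℕ → (ℕ → Expr) → Expr
Σ₀ zero    f = f 0
Σ₀ (suc n) f = Σ₀ n f ⊕ f (suc n)

monomial : ℕ → Expr
monomial k = var (va k) ⊗ (pow (var vb) (k C 2) ⊗ pow (var vc) k)

term : Expr → ℕ → Expr
term J k = J ⊗ var (va k) ⊗ pow (var vb) (k C 2) ⊗ pow (var vc) k

weight : ℕ → Expr
weight k = num k ⊗ (num k ⊕ var vz)

JSExpansion : ℕ → Expr
JSExpansion n = Σ₀ n (λ k → term (JS n k) k)

data Scalar : Expr → Set where
  z   : Scalar (var vz)
  num : ∀ m → Scalar (num m)
  _⊕_ : ∀ {e f} → Scalar e → Scalar f → Scalar (e ⊕ f)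
  _⊗_ : ∀ {e f} → Scalar e → Scalar f → Scalar (e ⊗ f)

JS-scalar : ∀ n k → Scalar (JS n k)
JS-scalar zero    zero    = num 1
JS-scalar zero    (suc k) = num 0
JS-scalar (suc n) zero    = num 0
JS-scalar (suc n) (suc k) = JS-scalar n k ⊕ num (suc k) ⊗ (num (suc k) ⊕ z) ⊗ JS-scalar n (suc k)

D-a : ∀ {m k} → k < m → D m (var (va k)) ≡ var (va (suc k)) ⊗ pow (var vb) k ⊗ var vc
D-a {m} {k} k<m with k <ᵇ m | <⇒<ᵇ k<m
... | true | _ = ≡.refl

module Calculus {c ℓ : Level} (R : CommutativeRing c ℓ) (ρ : Var → CommutativeRing.Carrier R) where
  open CommutativeRing R
  open Eval R
  open SemiringRangeSum semiring
  open SemiringMult semiring using (_×_; ×-homo-+; ×1-homo-*)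
  -- The solver's constant con n is not definitionally fromℕ n, so a numeral of Defs such as
  -- fromℕ 2 = 1# + (1# + 0#) is spelled con 1 :+ (con 1 :+ con 0) in solver terms.
  open NaturalSolver commutativeSemiring using (solve; _:=_; _:+_; _:*_; con)
  open SetoidReasoning setoid

  fromℕ≡×1# : ∀ m → fromℕ m ≡ m × 1#
  fromℕ≡×1# zero    = ≡.refl
  fromℕ≡×1# (suc m) = ≡.cong (1# +_) (fromℕ≡×1# m)

  fromℕ-+ : ∀ m n → fromℕ (m ℕ.+ n) ≈ fromℕ m + fromℕ n
  fromℕ-+ m n rewrite fromℕ≡×1# (m ℕ.+ n) | fromℕ≡×1# m | fromℕ≡×1# n = ×-homo-+ 1# m n

  fromℕ-* : ∀ m n → fromℕ (m ℕ.* n) ≈ fromℕ m * fromℕ n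
  fromℕ-* m n rewrite fromℕ≡×1# (m ℕ.* n) | fromℕ≡×1# m | fromℕ≡×1# n = ×1-homo-* m n

  ⟦Σ₀⟧ : ∀ n f → ⟦ Σ₀ n f ⟧ ρ ≡ ∑≤ n (λ k → ⟦ f k ⟧ ρ)
  ⟦Σ₀⟧ zero    f = ≡.refl
  ⟦Σ₀⟧ (suc n) f = ≡.cong (_+ ⟦ f (suc n) ⟧ ρ) (⟦Σ₀⟧ n f)

  ⟦D-Σ₀⟧ : ∀ m n f → ⟦ D m (Σ₀ n f) ⟧ ρ ≡ ∑≤ n (λ k → ⟦ D m (f k) ⟧ ρ)
  ⟦D-Σ₀⟧ m zero    f = ≡.refl
  ⟦D-Σ₀⟧ m (suc n) f = ≡.cong (_+ ⟦ D m (f (suc n)) ⟧ ρ) (⟦D-Σ₀⟧ m n f)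

  ⟦Σ₀⟧≈⟦f0⟧+⟦Σ₁⟧ : ∀ n f → ⟦ Σ₀ n f ⟧ ρ ≈ ⟦ f 0 ⟧ ρ + ⟦ Σ₁ n f ⟧ ρ
  ⟦Σ₀⟧≈⟦f0⟧+⟦Σ₁⟧ zero    f = sym (+-identityʳ _)
  ⟦Σ₀⟧≈⟦f0⟧+⟦Σ₁⟧ (suc n) f = trans (+-congʳ (⟦Σ₀⟧≈⟦f0⟧+⟦Σ₁⟧ n f)) (+-assoc _ _ _)

  ⟦pow⟧-+ : ∀ e i j → ⟦ pow e (i ℕ.+ j) ⟧ ρ ≈ ⟦ pow e i ⟧ ρ * ⟦ pow e j ⟧ ρ
  ⟦pow⟧-+ e zero    j = sym (trans (*-congʳ (+-identityʳ 1#)) (*-identityˡ _))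
  ⟦pow⟧-+ e (suc i) j = trans (*-congˡ (⟦pow⟧-+ e i j)) (sym (*-assoc _ _ _))

  ⟦term⟧ : ∀ J k → ⟦ term J k ⟧ ρ ≈ ⟦ J ⊗ monomial k ⟧ ρ
  ⟦term⟧ J k = trans (*-assoc _ _ _) (*-assoc _ _ _)

  D-⊗ : ∀ {m x y} e f → ⟦ D m e ⟧ ρ ≈ x → ⟦ D m f ⟧ ρ ≈ y → ⟦ D m (e ⊗ f) ⟧ ρ ≈ x * ⟦ f ⟧ ρ + ⟦ e ⟧ ρ * y
  D-⊗ _ _ De≈x Df≈y = +-cong (*-congʳ De≈x) (*-congˡ Df≈y)

  D-scalar : ∀ {m e} → Scalar e → ⟦ D m e ⟧ ρ ≈ 0#
  D-scalar z       = refl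
  D-scalar (num k) = refl
  D-scalar (s ⊕ t) = trans (+-cong (D-scalar s) (D-scalar t)) (+-identityˡ 0#)
  D-scalar (s ⊗ t) = trans (+-cong (trans (*-congʳ (D-scalar s)) (zeroˡ _)) (trans (*-congˡ (D-scalar t)) (zeroʳ _)))
                            (+-identityˡ 0#)

  D-pow : ∀ {m κ} e j → ⟦ D m e ⟧ ρ ≈ κ * ⟦ e ⟧ ρ → ⟦ D m (pow e j) ⟧ ρ ≈ (fromℕ j * κ) * ⟦ pow e j ⟧ ρ
  D-pow {κ = κ} e zero    _     = solve 1 (λ κ → con 0 := (con 0 :* κ) :* (con 1 :+ con 0)) refl κ
  D-pow {κ = κ} e (suc j) De≈κe = trans (D-⊗ e (pow e j) De≈κe (D-pow e j De≈κe))
    (solve 4 (λ κ x p n → (κ :* x) :* p :+ x :* ((n :* κ) :* p) := ((con 1 :+ n) :* κ) :* (x :* p)) refl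
      κ (⟦ e ⟧ ρ) (⟦ pow e j ⟧ ρ) (fromℕ j))

  eigenvalue : ∀ k → fromℕ (k C 2) * fromℕ 2 + fromℕ k * (fromℕ 1 + ρ vz) ≈ ⟦ weight k ⟧ ρ
  eigenvalue k = begin
    p * fromℕ 2 + q * (fromℕ 1 + ρ vz)  ≈⟨ regroup p q (ρ vz) ⟩
    (p + p + q) + q * ρ vz              ≈⟨ +-congʳ square ⟩
    q * q + q * ρ vz                    ≈⟨ distribˡ q q (ρ vz) ⟨
    q * (q + ρ vz)                      ∎
    where
    p q : Carrier
    p = fromℕ (k C 2)
    q = fromℕ k
    square : p + p + q ≈ q * q
    square = begin
      p + p + q                           ≈⟨ trans (fromℕ-+ (k C 2 ℕ.+ k C 2) k) (+-congʳ (fromℕ-+ (k C 2) (k C 2))) ⟨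
      fromℕ (k C 2 ℕ.+ k C 2 ℕ.+ k)        ≡⟨ ≡.cong fromℕ (nC2+nC2+n≡n*n k) ⟩
      fromℕ (k ℕ.* k)                      ≈⟨ fromℕ-* k k ⟩
      q * q                               ∎

    regroup : ∀ p q z → p * fromℕ 2 + q * (fromℕ 1 + z) ≈ (p + p + q) + q * z
    regroup = solve 3 (λ p q z →
      p :* (con 1 :+ (con 1 :+ con 0)) :+ q :* ((con 1 :+ con 0) :+ z) := (p :+ p :+ q) :+ q :* z) refl

  D-term : ∀ {m k} J → k < m → ⟦ D m J ⟧ ρ ≈ 0# →
           ⟦ D m (term J k) ⟧ ρ ≈ ⟦ J ⊗ monomial (suc k) ⊕ weight k ⊗ (J ⊗ monomial k) ⟧ ρ
  D-term {m} {k} J k<m DJ≈0 = begin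
    ⟦ D m (term J k) ⟧ ρ
      ≈⟨ D-⊗ (J ⊗ a ⊗ b^kC2) c^k (D-⊗ (J ⊗ a) b^kC2 (D-⊗ J a DJ≈0 Da) (D-pow (var vb) (k C 2) refl))
                                (D-pow (var vc) k refl) ⟩
    ((0# * ⟦ a ⟧ ρ + j * ⟦ a′ ⊗ β k ⊗ var vc ⟧ ρ) * B + (j * ⟦ a ⟧ ρ) * (κb * B)) * Γ
      + ((j * ⟦ a ⟧ ρ) * B) * (κc * Γ)
      ≈⟨ regroup j (⟦ a ⟧ ρ) (⟦ a′ ⟧ ρ) (⟦ β k ⟧ ρ) B (ρ vc) Γ κb κc ⟩
    j * (⟦ a′ ⟧ ρ * ((⟦ β k ⟧ ρ * B) * (ρ vc * Γ))) + (κb + κc) * (j * ⟦ monomial k ⟧ ρ)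
      ≈⟨ +-cong (*-congˡ (*-congˡ (*-congʳ β-shift))) (*-congʳ (eigenvalue k)) ⟩
    ⟦ J ⊗ monomial (suc k) ⊕ weight k ⊗ (J ⊗ monomial k) ⟧ ρ ∎
    where
    a a′ b^kC2 c^k : Expr
    a     = var (va k)
    a′    = var (va (suc k))
    b^kC2 = pow (var vb) (k C 2)
    c^k   = pow (var vc) k
    β : ℕ → Expr
    β = pow (var vb)
    j B Γ κb κc : Carrier
    j  = ⟦ J ⟧ ρ
    B  = ⟦ b^kC2 ⟧ ρ
    Γ  = ⟦ c^k ⟧ ρ
    κb = fromℕ (k C 2) * fromℕ 2
    κc = fromℕ k * (fromℕ 1 + ρ vz)

    Da : ⟦ D m a ⟧ ρ ≈ ⟦ a′ ⊗ β k ⊗ var vc ⟧ ρ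
    Da = reflexive (≡.cong (λ e → ⟦ e ⟧ ρ) (D-a k<m))

    β-shift : ⟦ β k ⟧ ρ * B ≈ ⟦ β (suc k C 2) ⟧ ρ
    β-shift = sym (trans (reflexive (≡.cong (λ i → ⟦ β i ⟧ ρ) ([1+n]C2≡n+nC2 k))) (⟦pow⟧-+ (var vb) k (k C 2)))

    regroup : ∀ j a a′ βk B c Γ κb κc →
      ((0# * a + j * ((a′ * βk) * c)) * B + (j * a) * (κb * B)) * Γ + ((j * a) * B) * (κc * Γ)
        ≈ j * (a′ * ((βk * B) * (c * Γ))) + (κb + κc) * (j * (a * (B * Γ)))
    regroup = solve 9 (λ j a a′ βk B c Γ κb κc →
      ((con 0 :* a :+ j :* ((a′ :* βk) :* c)) :* B :+ (j :* a) :* (κb :* B)) :* Γ :+ ((j :* a) :* B) :* (κc :* Γ)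
        := j :* (a′ :* ((βk :* B) :* (c :* Γ))) :+ (κb :+ κc) :* (j :* (a :* (B :* Γ)))) refl

  JS-vanishes : ∀ {n k} → n < k → ⟦ JS n k ⟧ ρ ≈ 0#
  JS-vanishes {zero}  {suc k} _         = refl
  JS-vanishes {suc n} {suc k} (s≤s n<k) =
    trans (+-cong (JS-vanishes n<k) (*-congˡ (JS-vanishes (m≤n⇒m≤1+n n<k)))) (trans (+-identityˡ _) (zeroʳ _))

  D-JSExpansion : ∀ n → ⟦ D (suc n) (JSExpansion n) ⟧ ρ ≈ ⟦ JSExpansion (suc n) ⟧ ρ
  D-JSExpansion n = begin
    ⟦ D (suc n) (JSExpansion n) ⟧ ρ
      ≡⟨ ⟦D-Σ₀⟧ (suc n) n (λ k → term (JS n k) k) ⟩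
    ∑≤ n (λ k → ⟦ D (suc n) (term (JS n k) k) ⟧ ρ)
      ≈⟨ ∑≤-cong n (λ k k≤n → D-term (JS n k) (s≤s k≤n) (D-scalar (JS-scalar n k))) ⟩
    ∑≤ n (λ k → js n k * μ (suc k) + w k * (js n k * μ k))
      ≈⟨ ∑≤-recurrence n (js n) (js (suc n)) w μ (JS-vanishes (n<1+n n)) (zeroˡ _) refl (λ _ → refl) ⟩
    ∑≤ (suc n) (λ k → js (suc n) k * μ k)
      ≈⟨ ∑≤-cong (suc n) (λ k _ → ⟦term⟧ (JS (suc n) k) k) ⟨
    ∑≤ (suc n) (λ k → ⟦ term (JS (suc n) k) k ⟧ ρ)
      ≡⟨ ⟦Σ₀⟧ (suc n) (λ k → term (JS (suc n) k) k) ⟨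
    ⟦ JSExpansion (suc n) ⟧ ρ ∎
    where
    js : ℕ → ℕ → Carrier
    js n k = ⟦ JS n k ⟧ ρ
    w μ : ℕ → Carrier
    w k = ⟦ weight k ⟧ ρ
    μ k = ⟦ monomial k ⟧ ρ

  JSExpansion-0 : ⟦ JSExpansion 0 ⟧ ρ ≈ ρ (va 0)
  JSExpansion-0 = solve 1 (λ a → ((con 1 :+ con 0) :* a :* (con 1 :+ con 0)) :* (con 1 :+ con 0) := a) refl (ρ (va 0))

module SemanticEquality (c ℓ : Level) where
  infix 4 _≐_
  _≐_ : Expr → Expr → Set (lsuc (c ⊔ ℓ))
  e ≐ f = ∀ (R : CommutativeRing c ℓ) ρ → CommutativeRing._≈_ R (Eval.⟦_⟧ R e ρ) (Eval.⟦_⟧ R f ρ)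

  D-cong : ∀ m e f → e ≐ f → D m e ≐ D m f
  D-cong m e f e≐f R ρ = begin
    ⟦ D m e ⟧ ρ                                   ≈⟨ proj₂ (⟦⟧-tangent m ρ e) ⟨
    proj₂ (Eval.⟦_⟧ dualNumbers e (tangent m ρ))  ≈⟨ proj₂ (e≐f dualNumbers (tangent m ρ)) ⟩
    proj₂ (Eval.⟦_⟧ dualNumbers f (tangent m ρ))  ≈⟨ proj₂ (⟦⟧-tangent m ρ f) ⟩
    ⟦ D m f ⟧ ρ                                   ∎
    where
    open CommutativeRing R
    open Eval R
    open DualNumbers R
    open SetoidReasoning setoid

  Dseq-a₀ : ∀ n → Dseq n (var (va 0)) ≐ JSExpansion n
  Dseq-a₀ zero    R ρ = CommutativeRing.sym R (Calculus.JSExpansion-0 R ρ)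
  Dseq-a₀ (suc n) R ρ = CommutativeRing.trans R
    (D-cong (suc n) (Dseq n (var (va 0))) (JSExpansion n) (Dseq-a₀ n) R ρ)
    (Calculus.D-JSExpansion R ρ n)

theorem2 : {c ℓ : Level} (R : CommutativeRing c ℓ) (ρ : Var → CommutativeRing.Carrier R) (n : ℕ) → 1 ≤ n →
    CommutativeRing._≈_ R (Eval.⟦_⟧ R (Dseq n (var (va 0))) ρ)
      (Eval.⟦_⟧ R (Σ₁ n (λ k → JS n k ⊗ var (va k) ⊗ pow (var vb) (k C 2) ⊗ pow (var vc) k)) ρ)
theorem2 {c} {ℓ} R ρ (suc n) _ = begin
  ⟦ Dseq (suc n) (var (va 0)) ⟧ ρ             ≈⟨ Dseq-a₀ (suc n) R ρ ⟩
  ⟦ JSExpansion (suc n) ⟧ ρ                   ≈⟨ ⟦Σ₀⟧≈⟦f0⟧+⟦Σ₁⟧ (suc n) summand ⟩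
  ⟦ summand 0 ⟧ ρ + ⟦ Σ₁ (suc n) summand ⟧ ρ  ≈⟨ +-congʳ (trans (⟦term⟧ (num 0) 0) (zeroˡ _)) ⟩
  0# + ⟦ Σ₁ (suc n) summand ⟧ ρ               ≈⟨ +-identityˡ _ ⟩
  ⟦ Σ₁ (suc n) summand ⟧ ρ                    ∎
  where
  open CommutativeRing R
  open Eval R
  open Calculus R ρ
  open SemanticEquality c ℓ
  open SetoidReasoning setoid

  summand : ℕ → Expr
  summand k = term (JS (suc n) k) k
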